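{- For every integer $n \geq 1$, the Fibonacci-run graph $\mathcal{R}_n$ has exactly $f_{n+2}$ vertices, i.e. $|V(\mathcal{R}_n)| = f_{n+2}$.
   Context: A binary string is called run-constrained if every run (maximal block) of consecutive $1$s in it is immediately followed by a run of $0$s of strictly greater length. For $n \geq 1$, the Fibonacci-run graph $\mathcal{R}_n$ has vertex set $\{ w \in \{0,1\}^n : w00 \text{ is a run-constrained string of length } n+2\}$, and two vertices are adjacent iff they differ in exactly one coordinate (Hamming distance $1$); thus $\mathcal{R}_n$ is an induced subgraph of the hypercube $Q_n$. Fibonacci numbers: $f_0 = 0$, $f_1 = 1$, $f_n = f_{n-1} + f_{n-2}$ for $n \geq 2$. -}

module Defs where

open import Data.Bool using (Bool; true; false; _∧_; if_then_else_; T)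
open import Data.Bool.Properties using () renaming (_≟_ to _≟ᵇ_)
open import Data.Nat using (ℕ; zero; suc; _+_; _<ᵇ_)
open import Data.Product using (_×_; _,_)
open import Data.List using (List; []; _∷_; _++_; map; filter; length)
open import Data.Vec using (Vec; toList) renaming ([] to []ᵥ; _∷_ to _∷ᵥ_)
open import Relation.Nullary.Decidable using (does; T?)

fib : ℕ → ℕ
fib zero = zero
fib (suc zero) = suc zero
fib (suc (suc n)) = fib (suc n) + fib n

runs : List Bool → List (Bool × ℕ)
runs [] = []
runs (b ∷ w) = push (runs w)
  where
  push : List (Bool × ℕ) → List (Bool × ℕ)
  push [] = (b , 1) ∷ []
  push ((c , k) ∷ rs) = if does (b ≟ᵇ c) then (c , suc k) ∷ rs else (b , 1) ∷ (c , k) ∷ rs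

runsOK : List (Bool × ℕ) → Bool
runsOK [] = true
runsOK ((false , _) ∷ rs) = runsOK rs
runsOK ((true , _) ∷ []) = false
runsOK ((true , k) ∷ (false , m) ∷ rs) = (k <ᵇ m) ∧ runsOK ((false , m) ∷ rs)
runsOK ((true , _) ∷ (true , _) ∷ _) = false

-- A binary string (true = 1, false = 0) is run-constrained
runConstrained : List Bool → Bool
runConstrained w = runsOK (runs w)

allVecs : (n : ℕ) → List (Vec Bool n)
allVecs zero = []ᵥ ∷ []
allVecs (suc n) = map (false ∷ᵥ_) (allVecs n) ++ map (true ∷ᵥ_) (allVecs n)

-- w is a vertex of the Fibonacci-run graph R_n iff w00 is run-constrained
isRunVertex : {n : ℕ} → Vec Bool n → Bool
isRunVertex w = runConstrained (toList w ++ false ∷ false ∷ [])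

-- The vertex set V(R_n), as a duplicate-free list of words of length n
runVertices : (n : ℕ) → List (Vec Bool n)
runVertices n = filter (λ w → T? (isRunVertex w)) (allVecs n)

-- Let F n count the words l of length n with l00 run-constrained, and X n k
-- those with 1^(k+1) l 00 run-constrained.  Deleting a leading 0 gives
-- F (n+1) = F n + X n 0.  In 1^(k+1) 0 l 00 the word l cannot start with 1
-- (a lone 0 after a run of 1s), and if it starts with 0 then one 1 and one 0
-- can be deleted, down to the admissible block 100.  By induction this gives
-- X (m+1) (k+1) = X m k and X (n+1) 0 = F n, hence F (n+2) = F (n+1) + F n.
module Submission where

open import Defs
open import Data.Bool using (Bool; true; false; T; _∧_; if_then_else_)
open import Data.List using (List; []; _∷_; _++_; map; filter; length; replicate)
open import Data.List.Properties using (filter-++; length-++; length-map)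
open import Data.Nat using (ℕ; zero; suc; _≥_; _+_; _<ᵇ_)
open import Data.Nat.Properties using (+-identityʳ)
open import Data.Product using (_×_; _,_)
open import Data.Vec using (Vec; toList) renaming (_∷_ to _∷ᵥ_)
open import Function using (_∘_)
open import Relation.Nullary.Decidable using (Dec; does; T?)
open import Relation.Unary using (Pred; Decidable)
open import Relation.Binary.PropositionalEquality
  using (_≡_; refl; sym; trans; cong; cong₂; module ≡-Reasoning)

filter-map : ∀ {a b p} {A : Set a} {B : Set b} {P : Pred B p} (P? : Decidable P)
             (f : A → B) (xs : List A) →
             filter P? (map f xs) ≡ map f (filter (P? ∘ f) xs)
filter-map P? f [] = refl
filter-map P? f (x ∷ xs) with does (P? (f x))
... | true  = cong (f x ∷_) (filter-map P? f xs)
... | false = filter-map P? f xs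

count : ℕ → (List Bool → Bool) → ℕ
count zero    P = if P [] then 1 else 0
count (suc n) P = count n (P ∘ (false ∷_)) + count n (P ∘ (true ∷_))

count-cong : ∀ n {P Q : List Bool → Bool} → (∀ l → P l ≡ Q l) → count n P ≡ count n Q
count-cong zero    P≡Q rewrite P≡Q [] = refl
count-cong (suc n) P≡Q =
  cong₂ _+_ (count-cong n (P≡Q ∘ (false ∷_))) (count-cong n (P≡Q ∘ (true ∷_)))

count-none : ∀ n {P : List Bool → Bool} → (∀ l → P l ≡ false) → count n P ≡ 0
count-none zero    P≡false rewrite P≡false [] = refl
count-none (suc n) P≡false =
  cong₂ _+_ (count-none n (P≡false ∘ (false ∷_))) (count-none n (P≡false ∘ (true ∷_)))

length-filter-allVecs : ∀ n (P : List Bool → Bool) →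
                        length (filter (T? ∘ P ∘ toList) (allVecs n)) ≡ count n P
length-filter-allVecs zero P with P []
... | true  = refl
... | false = refl
length-filter-allVecs (suc n) P = begin
  length (filter P? (map (false ∷ᵥ_) words ++ map (true ∷ᵥ_) words))
    ≡⟨ cong length (filter-++ P? (map (false ∷ᵥ_) words) _) ⟩
  length (filter P? (map (false ∷ᵥ_) words) ++ filter P? (map (true ∷ᵥ_) words))
    ≡⟨ length-++ (filter P? (map (false ∷ᵥ_) words)) ⟩
  length (filter P? (map (false ∷ᵥ_) words)) + length (filter P? (map (true ∷ᵥ_) words))
    ≡⟨ cong₂ _+_ (extend false) (extend true) ⟩
  count (suc n) P ∎
  where
  open ≡-Reasoning
  words : List (Vec Bool n)
  words = allVecs n
  P? : (w : Vec Bool (suc n)) → Dec (T (P (toList w)))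
  P? = T? ∘ P ∘ toList
  extend : ∀ b → length (filter P? (map (b ∷ᵥ_) words)) ≡ count n (P ∘ (b ∷_))
  extend b = begin
    length (filter P? (map (b ∷ᵥ_) words))
      ≡⟨ cong length (filter-map P? (b ∷ᵥ_) words) ⟩
    length (map (b ∷ᵥ_) (filter (P? ∘ (b ∷ᵥ_)) words))
      ≡⟨ length-map (b ∷ᵥ_) (filter (P? ∘ (b ∷ᵥ_)) words) ⟩
    length (filter (P? ∘ (b ∷ᵥ_)) words)
      ≡⟨ length-filter-allVecs n (P ∘ (b ∷_)) ⟩
    count n (P ∘ (b ∷_)) ∎

zeroRun : List (Bool × ℕ) → ℕ
zeroRun ((false , m) ∷ _) = m
zeroRun _                 = 0

dropZeroRun : List (Bool × ℕ) → List (Bool × ℕ)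
dropZeroRun ((false , _) ∷ rs) = rs
dropZeroRun rs                 = rs

runsOK-dropZeroRun : ∀ rs → runsOK (dropZeroRun rs) ≡ runsOK rs
runsOK-dropZeroRun []                 = refl
runsOK-dropZeroRun ((false , _) ∷ rs) = refl
runsOK-dropZeroRun ((true  , _) ∷ rs) = refl

zeroRun-runs-true∷ : ∀ s → zeroRun (runs (true ∷ s)) ≡ 0
zeroRun-runs-true∷ s with runs s
... | []               = refl
... | (true  , _) ∷ _ = refl
... | (false , _) ∷ _ = refl

runs-zeros++ : ∀ j s → runs (replicate (suc j) false ++ s)
                       ≡ (false , suc j + zeroRun (runs s)) ∷ dropZeroRun (runs s)
runs-zeros++ zero s with runs s
... | []               = refl
... | (true  , _) ∷ _ = refl
... | (false , _) ∷ _ = refl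
runs-zeros++ (suc j) s rewrite runs-zeros++ j s = refl

runs-ones++ : ∀ k s {m rs} → runs s ≡ (false , m) ∷ rs →
              runs (replicate (suc k) true ++ s) ≡ (true , suc k) ∷ (false , m) ∷ rs
runs-ones++ zero    s eq rewrite eq                 = refl
runs-ones++ (suc k) s eq rewrite runs-ones++ k s eq = refl

runConstrained-ones-zeros++ :
  ∀ k j s → runConstrained (replicate (suc k) true ++ replicate (suc j) false ++ s)
            ≡ (suc k <ᵇ suc j + zeroRun (runs s)) ∧ runConstrained s
runConstrained-ones-zeros++ k j s =
  trans (cong runsOK (runs-ones++ k (replicate (suc j) false ++ s) (runs-zeros++ j s)))
        (cong ((suc k <ᵇ suc j + zeroRun (runs s)) ∧_) (runsOK-dropZeroRun (runs s)))

runConstrained-false∷ : ∀ s → runConstrained (false ∷ s) ≡ runConstrained s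
runConstrained-false∷ s =
  trans (cong runsOK (runs-zeros++ 0 s)) (runsOK-dropZeroRun (runs s))

runConstrained-100++ : ∀ s → runConstrained (true ∷ false ∷ false ∷ s) ≡ runConstrained s
runConstrained-100++ = runConstrained-ones-zeros++ 0 1

runConstrained-ones-00++ :
  ∀ k s → runConstrained (replicate (suc (suc k)) true ++ false ∷ false ∷ s)
          ≡ runConstrained (replicate (suc k) true ++ false ∷ s)
runConstrained-ones-00++ k s =
  trans (runConstrained-ones-zeros++ (suc k) 1 s) (sym (runConstrained-ones-zeros++ k 0 s))

runConstrained-ones-01++ : ∀ k s → runConstrained (replicate (suc k) true ++ false ∷ true ∷ s) ≡ false
runConstrained-ones-01++ k s
  rewrite runConstrained-ones-zeros++ k 0 (true ∷ s) | zeroRun-runs-true∷ s = refl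

replicate-++-∷ : ∀ {a} {A : Set a} n (x : A) xs → replicate n x ++ x ∷ xs ≡ replicate (suc n) x ++ xs
replicate-++-∷ zero    x xs = refl
replicate-++-∷ (suc n) x xs = cong (x ∷_) (replicate-++-∷ n x xs)

vertexCount : ℕ → ℕ
vertexCount n = count n (λ l → runConstrained (l ++ false ∷ false ∷ []))

countAfterOnes : ℕ → ℕ → ℕ
countAfterOnes n k =
  count n (λ l → runConstrained (replicate (suc k) true ++ l ++ false ∷ false ∷ []))

countAfterOnesZero : ℕ → ℕ → ℕ
countAfterOnesZero n k =
  count n (λ l → runConstrained (replicate (suc k) true ++ false ∷ l ++ false ∷ false ∷ []))

vertexCount-suc : ∀ n → vertexCount (suc n) ≡ vertexCount n + countAfterOnes n 0
vertexCount-suc n =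
  cong (_+ countAfterOnes n 0)
       (count-cong n (λ l → runConstrained-false∷ (l ++ false ∷ false ∷ [])))

countAfterOnes-suc : ∀ n k → countAfterOnes (suc n) k ≡ countAfterOnesZero n k + countAfterOnes n (suc k)
countAfterOnes-suc n k =
  cong (countAfterOnesZero n k +_)
       (count-cong n (λ l → cong runConstrained (replicate-++-∷ (suc k) true (l ++ false ∷ false ∷ []))))

countAfterOnesZero-suc-zero : ∀ n → countAfterOnesZero (suc n) 0 ≡ vertexCount n
countAfterOnesZero-suc-zero n =
  trans (cong₂ _+_ (count-cong n (λ l → runConstrained-100++ (l ++ false ∷ false ∷ [])))
                   (count-none n (λ l → runConstrained-ones-01++ 0 (l ++ false ∷ false ∷ []))))
        (+-identityʳ _)

countAfterOnesZero-suc-suc : ∀ n k → countAfterOnesZero (suc n) (suc k) ≡ countAfterOnesZero n k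
countAfterOnesZero-suc-suc n k =
  trans (cong₂ _+_ (count-cong n (λ l → runConstrained-ones-00++ k (l ++ false ∷ false ∷ [])))
                   (count-none n (λ l → runConstrained-ones-01++ (suc k) (l ++ false ∷ false ∷ []))))
        (+-identityʳ _)

countAfterOnes-zero-suc : ∀ k → countAfterOnes 0 (suc k) ≡ 0
countAfterOnes-zero-suc k =
  cong (λ b → if b then 1 else 0) (runConstrained-ones-zeros++ (suc k) 1 [])

countAfterOnesZero-zero-suc-suc : ∀ k → countAfterOnesZero 0 (suc (suc k)) ≡ 0
countAfterOnesZero-zero-suc-suc k =
  cong (λ b → if b then 1 else 0) (runConstrained-ones-zeros++ (suc (suc k)) 2 [])

countAfterOnes-suc-suc : ∀ m k → countAfterOnes (suc m) (suc k) ≡ countAfterOnes m k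
countAfterOnes-suc-suc zero zero    = refl
countAfterOnes-suc-suc zero (suc k) = begin
  countAfterOnes 1 (suc (suc k))
    ≡⟨ countAfterOnes-suc 0 (suc (suc k)) ⟩
  countAfterOnesZero 0 (suc (suc k)) + countAfterOnes 0 (suc (suc (suc k)))
    ≡⟨ cong₂ _+_ (countAfterOnesZero-zero-suc-suc k) (countAfterOnes-zero-suc (suc (suc k))) ⟩
  0
    ≡⟨ countAfterOnes-zero-suc k ⟨
  countAfterOnes 0 (suc k) ∎
  where open ≡-Reasoning
countAfterOnes-suc-suc (suc m) k = begin
  countAfterOnes (suc (suc m)) (suc k)
    ≡⟨ countAfterOnes-suc (suc m) (suc k) ⟩
  countAfterOnesZero (suc m) (suc k) + countAfterOnes (suc m) (suc (suc k))
    ≡⟨ cong₂ _+_ (countAfterOnesZero-suc-suc m k) (countAfterOnes-suc-suc m (suc k)) ⟩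
  countAfterOnesZero m k + countAfterOnes m (suc k)
    ≡⟨ countAfterOnes-suc m k ⟨
  countAfterOnes (suc m) k ∎
  where open ≡-Reasoning

countAfterOnes-suc-zero : ∀ n → countAfterOnes (suc n) 0 ≡ vertexCount n
countAfterOnes-suc-zero zero    = refl
countAfterOnes-suc-zero (suc n) = begin
  countAfterOnes (suc (suc n)) 0
    ≡⟨ countAfterOnes-suc (suc n) 0 ⟩
  countAfterOnesZero (suc n) 0 + countAfterOnes (suc n) 1
    ≡⟨ cong₂ _+_ (countAfterOnesZero-suc-zero n) (countAfterOnes-suc-suc n 0) ⟩
  vertexCount n + countAfterOnes n 0
    ≡⟨ vertexCount-suc n ⟨
  vertexCount (suc n) ∎
  where open ≡-Reasoning

vertexCount≡fib : ∀ n → vertexCount n ≡ fib (n + 2)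
vertexCount≡fib zero          = refl
vertexCount≡fib (suc zero)    = refl
vertexCount≡fib (suc (suc n)) = begin
  vertexCount (suc (suc n))
    ≡⟨ vertexCount-suc (suc n) ⟩
  vertexCount (suc n) + countAfterOnes (suc n) 0
    ≡⟨ cong (vertexCount (suc n) +_) (countAfterOnes-suc-zero n) ⟩
  vertexCount (suc n) + vertexCount n
    ≡⟨ cong₂ _+_ (vertexCount≡fib (suc n)) (vertexCount≡fib n) ⟩
  fib (suc n + 2) + fib (n + 2) ∎
  where open ≡-Reasoning

-- The count is also correct for n = 0.
lemma3p1 : (n : ℕ) → n ≥ 1 → length (runVertices n) ≡ fib (n + 2)
lemma3p1 n _ = trans (length-filter-allVecs n (λ l → runConstrained (l ++ false ∷ false ∷ [])))
                     (vertexCount≡fib n)
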